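{- Let $G$ be an abelian group of order $n=4t+2$ (written additively, $t\ge1$), and let $D$ be a $k$-subset of $G$ with characteristic function $\chi:G\to\mathrm{GF}(2)$. Let $\phi(x)=(-1)^{\chi(x)}$ and $R=\{(\phi(g),g)\mid g\in G\}\subset\{\pm1\}\times G$. Then the following are equivalent: (i) $\partial\phi$ is quasi-orthogonal; (ii) $D$ is a $(4t+2,k,k-(t+1),(4t+1)(k-t)-k(k-1))$-almost difference set in $G$; (iii) $R$ is an extremal relative $(4t+2,2,4t+2,2t+1)$-quasi-difference set in $\{\pm1\}\times G$ with forbidden subgroup $\{\pm1\}\times\{0\}$; (iv) $\phi$ is an optimal binary array, i.e. $R_\phi(g)=\pm2$ for all $g\in G\setminus\{0\}$. If no difference set with parameters $\bigl(n,\frac{n\pm\sqrt{3n-2}}{2},\frac{n+2\pm2\sqrt{3n-2}}{4}\bigr)$ exists, then (i)–(iv) are further equivalent to (v) $\chi$ has optimal nonlinearity $(t+1)/(2t+1)$.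
   Context: $\partial\phi(x,y)=\phi(x)\phi(y)\phi(x+y)$; $R_\phi(g)=\sum_{x\in G}\phi(x)\phi(x+g)$. For a normalized cocycle $\psi:G\times G\to\{\pm1\}$ with matrix $M_\psi=[\psi(g,h)]_{g,h}$, the row excess is $RE(M_\psi)=\sum_{g\ne0}|\sum_h\psi(g,h)|$; a coboundary $\psi$ (such as $\partial\phi$) is quasi-orthogonal iff $RE(M_\psi)=8t+2$ (a non-coboundary is quasi-orthogonal iff $RE=4t$). A $(v,k,\lambda,s)$-almost difference set in $G$ ($|G|=v$) is a $k$-subset $D$ such that for $s$ of the nonzero $g\in G$ the number of pairs $(x,y)\in D^2$ with $x-y=g$ is $\lambda$, and for the remaining $v-1-s$ nonzero $g$ it is $\lambda+1$. Relative quasi-difference set: for a group $\mathcal E$ of order $8t+4$ and normal $Z\cong\mathbb Z_2$, a transversal $R$ for $Z$ in $\mathcal E$ containing $S\subset R\setminus\{1\}$ with $|S|\in\{0,2t+1\}$ such that for all $x\in\mathcal E\setminus Z$, $|R\cap xR|=2t+1$ if $x\in SZ$ and $|R\cap xR|\in\{2t,2t+2\}$ otherwise; extremal means $S=\emptyset$. Nonlinearity of $f:G\to\mathrm{GF}(2)$: $P_f=\max_{0\ne a\in G}\max_{b\in\mathrm{GF}(2)}|\{x\in G: f(x+a)-f(x)=b\}|/|G|$; for $|G|=4t+2$ the optimal value is $(t+1)/(2t+1)$. A $(v,k,\lambda)$-difference set is a $k$-subset of a group of order $v$ in which every nonidentity element has exactly $\lambda$ representations as a difference. -}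

module Defs where

open import Data.Bool using (Bool; true; false; _∧_; _xor_; if_then_else_; not)
open import Data.Nat as ℕ using (ℕ; _⊔_; _∸_)
open import Data.Integer as ℤ using (ℤ; +_; _◃_; ∣_∣)
open import Data.Rational as ℚ using (ℚ)
open import Data.Sign as Sign using (Sign)
open import Data.Fin using (Fin)
import Data.Fin as Fin
open import Data.List using (List; []; _∷_; map; foldr; allFin; concatMap)
open import Data.Product using (Σ; _×_; _,_; proj₁; proj₂)
open import Data.Sum using (_⊎_)
open import Relation.Binary.PropositionalEquality using (_≡_)
open import Relation.Nullary using (¬_; does)
open import Algebra.Structures using (IsAbelianGroup)

∑ : {A : Set} → List A → (A → ℤ) → ℤ
∑ xs f = foldr (λ x acc → f x ℤ.+ acc) (+ 0) xs

∑ℕ : {A : Set} → List A → (A → ℕ) → ℕ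
∑ℕ xs f = foldr (λ x acc → f x ℕ.+ acc) 0 xs

count : {A : Set} → List A → (A → Bool) → ℕ
count xs p = foldr (λ x acc → if p x then ℕ.suc acc else acc) 0 xs

maxℕ : {A : Set} → List A → (A → ℕ) → ℕ
maxℕ xs f = foldr (λ x acc → f x ⊔ acc) 0 xs

record FinAbGroup (n : ℕ) : Set where
  field
    _⊕_ : Fin n → Fin n → Fin n
    𝟘   : Fin n
    ⊖_  : Fin n → Fin n
    isAbelianGroup : IsAbelianGroup _≡_ _⊕_ 𝟘 ⊖_

  infixl 6 _⊕_ _⊖_
  _⊖_ : Fin n → Fin n → Fin n
  x ⊖ y = x ⊕ (⊖ y)

  elems : List (Fin n)
  elems = allFin n

  nonzero : Fin n → Bool
  nonzero g = not (does (g Fin.≟ 𝟘))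

  nzElems : List (Fin n)
  nzElems = Data.List.filterᵇ nonzero elems
    where import Data.List

module _ {n : ℕ} (G : FinAbGroup n) where
  open FinAbGroup G

  -- ±1 values are represented by Data.Sign.Sign (+ ↦ 1, - ↦ -1)

  val : Sign → ℤ
  val s = s ◃ 1

  -- φ(x) = (-1)^{χ(x)}, with GF(2) represented by Bool (true = 1)
  signOf : (Fin n → Bool) → Fin n → Sign
  signOf χ x = if χ x then Sign.- else Sign.+

  ∂ : (Fin n → Sign) → Fin n → Fin n → Sign
  ∂ φ x y = φ x Sign.* φ y Sign.* φ (x ⊕ y)

  IsCoboundary : (Fin n → Fin n → Sign) → Set
  IsCoboundary ψ = Σ (Fin n → Sign) λ φ → ∀ g h → ψ g h ≡ ∂ φ g h

  RE : (Fin n → Fin n → Sign) → ℕ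
  RE ψ = ∑ℕ nzElems (λ g → ∣ ∑ elems (λ h → val (ψ g h)) ∣)

  -- quasi-orthogonality of a cocycle over G of order 4t+2
  QuasiOrthogonal : ℕ → (Fin n → Fin n → Sign) → Set
  QuasiOrthogonal t ψ =
    (IsCoboundary ψ × RE ψ ≡ 8 ℕ.* t ℕ.+ 2) ⊎ (¬ IsCoboundary ψ × RE ψ ≡ 4 ℕ.* t)

  -- subsets of G are given by their characteristic functions Fin n → Bool

  diffCount : (Fin n → Bool) → Fin n → ℕ
  diffCount D g =
    ∑ℕ elems (λ x → count elems (λ y → D x ∧ D y ∧ does ((x ⊖ y) Fin.≟ g)))

  -- (v,k,λ,s)-almost difference set (λ, s integers as in the paper's parameters)
  IsAlmostDifferenceSet : ℕ → ℕ → ℤ → ℤ → (Fin n → Bool) → Set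
  IsAlmostDifferenceSet v k l s D =
    v ≡ n
    × count elems D ≡ k
    × (+ count nzElems (λ g → does (+ diffCount D g ℤ.≟ l)) ≡ s)
    × (∀ g → nonzero g ≡ true →
         (+ diffCount D g ≡ l) ⊎ (+ diffCount D g ≡ l ℤ.+ + 1))

  IsDifferenceSet : ℕ → ℕ → ℕ → (Fin n → Bool) → Set
  IsDifferenceSet v k l D =
    v ≡ n × count elems D ≡ k × (∀ g → nonzero g ≡ true → diffCount D g ≡ l)

  autocorr : (Fin n → Sign) → Fin n → ℤ
  autocorr φ g = ∑ elems (λ x → val (φ x Sign.* φ (x ⊕ g)))

  IsOptimalBinaryArray : (Fin n → Sign) → Set
  IsOptimalBinaryArray φ =
    ∀ g → nonzero g ≡ true → (autocorr φ g ≡ + 2) ⊎ (autocorr φ g ≡ ℤ.- (+ 2))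

  -- nonlinearity P_f = max_{a≠0} max_{b∈GF(2)} #{x : f(x+a) - f(x) = b} / |G|
  -- (in GF(2), subtraction is xor)
  maxDerivCount : (Fin n → Bool) → ℕ
  maxDerivCount f =
    maxℕ nzElems (λ a →
      maxℕ (false ∷ true ∷ []) (λ b →
        count elems (λ x → does ((f (x ⊕ a) xor f x) Data.Bool.≟ b))))
    where import Data.Bool

  nonlinearity : (f : Fin n → Bool) → .{{ℕ.NonZero n}} → ℚ
  nonlinearity f = (+ maxDerivCount f) ℚ./ n

  -- The group E = {±1} × G (direct product) and its forbidden subgroup
  -- Z = {±1} × {0}

  E : Set
  E = Sign × Fin n

  _·E_ : E → E → E
  (a , g) ·E (b , h) = (a Sign.* b , g ⊕ h)

  invE : E → E
  invE (a , g) = (a , ⊖ g)   -- a * a = +1 in {±1}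

  elemsE : List E
  elemsE = concatMap (λ s → map (λ g → (s , g)) elems) (Sign.+ ∷ Sign.- ∷ [])

  Zfb : E → Bool
  Zfb (_ , g) = does (g Fin.≟ 𝟘)

  graphSet : (Fin n → Sign) → E → Bool
  graphSet φ (s , g) = does (s Sign.≟ φ g)

-- Extremal relative (m,n',k,λ)-quasi-difference set R in a finite group
-- (elements listed by `elems`, multiplication _·_, inverse inv) with
-- forbidden subgroup Z (extremal: S = ∅).
-- |E| = m n', |Z| = n', |R| = k, R a transversal of Z, and
-- |R ∩ xR| ∈ {λ-1, λ+1} for all x ∉ Z.

IsExtremalRQDS : {A : Set} (elems : List A) (_·_ : A → A → A) (inv : A → A)
                 (m n' k l : ℕ) (Z R : A → Bool) → Set
IsExtremalRQDS elems _·_ inv m n' k l Z R =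
  count elems (λ _ → true) ≡ m ℕ.* n'
  × count elems Z ≡ n'
  × count elems R ≡ k
  -- transversal: every coset xZ meets R in exactly one element
  × (∀ x → count elems (λ z → Z z ∧ R (x · z)) ≡ 1)
  -- |R ∩ xR| ∈ {λ - 1, λ + 1} for x ∉ Z  (y ∈ xR iff x⁻¹y ∈ R)
  × (∀ x → Z x ≡ false →
       let c = count elems (λ y → R y ∧ R (inv x · y)) in
       (c ≡ l ∸ 1) ⊎ (c ≡ ℕ.suc l))

-- Let D be the support of χ and u(g) = |D ∖ (D − g)| the number of points of D that the
-- translation by g moves out of D. A sum over x of any function of (χ x, χ (x + g)) only
-- depends on n, |D| and u(g), so every quantity in (i)–(v) is affine in u(g): R_φ(g) is
-- n − 4u(g), and row g of M_∂φ sums to φ(g) R_φ(g); the difference function of D is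
-- |D| − u(g); |R ∩ (±1, g)R| is n − 2u(g) resp. 2u(g); and the numbers of x with
-- χ(x + g) − χ(x) = 0 resp. 1 are n − 2u(g) resp. 2u(g). With n = 4t + 2 each condition
-- therefore says exactly that u(g) ∈ {t, t + 1} for all g ≠ 0: for (i) because
-- |2 − 4w| ≥ 2 with equality iff w ∈ {0, 1}; for (v) because n − 2u(g) and 2u(g) are
-- both at most 2t + 2 iff u(g) ∈ {t, t + 1}, while one of them always exceeds 2t + 1.
-- The parameter s in (ii) comes from Σ_g u(g) = n|D| − |D|².

module Submission where

open import Defs
open import Algebra.Bundles using (Group)
open import Algebra.Structures using (IsAbelianGroup)
open import Data.Bool using (Bool; true; false; _∧_; _xor_; not; if_then_else_)
import Data.Bool as Bool
import Data.Bool.Properties as BoolP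
open import Data.Fin using (Fin; zero; suc)
import Data.Fin as Fin
open import Data.Fin.Permutation using (permutation)
open import Data.Integer as ℤ using (ℤ; +_; -[1+_]; 0ℤ)
import Data.Integer.Properties as ℤP
open import Data.Integer.Tactic.RingSolver using (solve-∀)
open import Data.List using (List; []; _∷_; _++_; map; length; tabulate; allFin; filterᵇ)
open import Data.List.Relation.Unary.All using (All; []; _∷_)
open import Data.Nat as ℕ using (ℕ; zero; suc; _∸_; NonZero; z≤n; s≤s)
import Data.Nat.Properties as ℕP
import Data.Nat.Tactic.RingSolver as ℕSolver
open import Data.Product using (_×_; _,_; proj₂)
import Data.Product
import Data.Rational as ℚ
import Data.Rational.Properties as ℚP
import Data.Rational.Unnormalised as ℚᵘ
open import Data.Sign as Sign using (Sign)
import Data.Sign.Properties as SignP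
open import Data.Sum using (_⊎_; inj₁; inj₂)
import Data.Sum as Sum
open import Function using (_∘_; _⇔_; mk⇔; Equivalence; Injective)
import Function.Properties.Equivalence as ⇔
open import Level using (0ℓ)
open import Relation.Binary.PropositionalEquality
open import Relation.Nullary using (does; contradiction)
open import Relation.Nullary.Decidable using (does-⇔)
open ≡-Reasoning

open import Algebra.Properties.Semiring.Sum ℤP.+-*-semiring
  using (sum; sum-cong-≗; ∑-distrib-+; ∑-comm; ∑-permute; *-distribˡ-sum; *-distribʳ-sum)

module Sums where
  open import Data.Integer.Base using (_+_; _*_; _-_; -_)

  𝟙 : Bool → ℤ
  𝟙 true  = + 1
  𝟙 false = + 0

  𝟙-∧ : ∀ a b → 𝟙 (a ∧ b) ≡ 𝟙 a * 𝟙 b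
  𝟙-∧ false b     = refl
  𝟙-∧ true  false = refl
  𝟙-∧ true  true  = refl

  sum-const : ∀ n c → sum {n} (λ _ → c) ≡ + n * c
  sum-const zero    c = refl
  sum-const (suc n) c = trans (cong (_+_ c) (sum-const n c)) (sym (ℤP.suc-* (+ n) c))

  sum-zero : ∀ n → sum {n} (λ _ → 0ℤ) ≡ 0ℤ
  sum-zero n = trans (sum-const n 0ℤ) (ℤP.*-zeroʳ (+ n))

  sum-neg : ∀ {n} (f : Fin n → ℤ) → sum (λ i → - f i) ≡ - sum f
  sum-neg {zero}  f = refl
  sum-neg {suc n} f = begin
    - f zero + sum (λ i → - f (suc i))  ≡⟨ cong (_+_ (- f zero)) (sum-neg (f ∘ suc)) ⟩
    - f zero - sum (f ∘ suc)            ≡⟨ ℤP.neg-distrib-+ (f zero) _ ⟨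
    - (f zero + sum (f ∘ suc))          ∎

  sum-sub : ∀ {n} (f g : Fin n → ℤ) → sum (λ i → f i - g i) ≡ sum f - sum g
  sum-sub f g = trans (∑-distrib-+ f (λ i → - g i)) (cong (_+_ (sum f)) (sum-neg g))

  sum-indicator : ∀ {n} (c : Fin n) (f : Fin n → ℤ) →
                  sum (λ i → 𝟙 (does (i Fin.≟ c)) * f i) ≡ f c
  sum-indicator {suc n} zero f = begin
    + 1 * f zero + sum {n} (λ _ → 0ℤ)  ≡⟨ cong₂ _+_ (ℤP.*-identityˡ (f zero)) (sum-zero n) ⟩
    f zero + 0ℤ                        ≡⟨ ℤP.+-identityʳ (f zero) ⟩
    f zero                             ∎
  sum-indicator {suc n} (suc c) f = trans (ℤP.+-identityˡ _) (sum-indicator c (f ∘ suc))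

  sum-𝟙-≟ : ∀ {n} (c : Fin n) → sum (λ i → 𝟙 (does (i Fin.≟ c))) ≡ + 1
  sum-𝟙-≟ c = trans (sum-cong-≗ (λ i → sym (ℤP.*-identityʳ (𝟙 (does (i Fin.≟ c))))))
                    (sum-indicator c (λ _ → + 1))

  sum-bijection : ∀ {n} (σ τ : Fin n → Fin n) → (∀ y → σ (τ y) ≡ y) → (∀ x → τ (σ x) ≡ x) →
                  (f : Fin n → ℤ) → sum (f ∘ σ) ≡ sum f
  sum-bijection σ τ στ τσ f = sym (∑-permute f (permutation σ τ στ τσ))

  sum-linear : ∀ {n} c₀ c₁ c₂ c₃ (a b d : Fin n → ℤ) →
               sum (λ x → c₀ + c₁ * a x + c₂ * b x + c₃ * d x) ≡
               + n * c₀ + c₁ * sum a + c₂ * sum b + c₃ * sum d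
  sum-linear {n} c₀ c₁ c₂ c₃ a b d = begin
    sum (λ x → c₀ + c₁ * a x + c₂ * b x + c₃ * d x)
      ≡⟨ ∑-distrib-+ (λ x → c₀ + c₁ * a x + c₂ * b x) c₃d ⟩
    sum (λ x → c₀ + c₁ * a x + c₂ * b x) + sum c₃d
      ≡⟨ cong (_+ sum c₃d) (∑-distrib-+ (λ x → c₀ + c₁ * a x) c₂b) ⟩
    sum (λ x → c₀ + c₁ * a x) + sum c₂b + sum c₃d
      ≡⟨ cong (λ s → s + sum c₂b + sum c₃d) (∑-distrib-+ (λ _ → c₀) c₁a) ⟩
    sum {n} (λ _ → c₀) + sum c₁a + sum c₂b + sum c₃d
      ≡⟨ cong₂ _+_ (cong₂ _+_ (cong₂ _+_ (sum-const n c₀) (sym (*-distribˡ-sum c₁ a)))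
                                         (sym (*-distribˡ-sum c₂ b)))
                               (sym (*-distribˡ-sum c₃ d)) ⟩
    + n * c₀ + c₁ * sum a + c₂ * sum b + c₃ * sum d ∎
    where c₁a c₂b c₃d : Fin n → ℤ
          c₁a x = c₁ * a x
          c₂b x = c₂ * b x
          c₃d x = c₃ * d x

  𝟙-interpolation : ∀ (f : Bool → Bool → ℤ) a b →
    f a b ≡ f false false + (f true false - f false false) * 𝟙 a
                          + (f false true - f false false) * 𝟙 b
                          + (f true true - f true false - f false true + f false false) * (𝟙 a * 𝟙 b)
  𝟙-interpolation f false false = ff (f false false) (f true false) (f false true) (f true true)
    where ff : ∀ p q r s → p ≡ p + (q - p) * + 0 + (r - p) * + 0 + (s - q - r + p) * (+ 0 * + 0)
          ff = solve-∀
  𝟙-interpolation f false true  = ft (f false false) (f true false) (f false true) (f true true)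
    where ft : ∀ p q r s → r ≡ p + (q - p) * + 0 + (r - p) * + 1 + (s - q - r + p) * (+ 0 * + 1)
          ft = solve-∀
  𝟙-interpolation f true  false = tf (f false false) (f true false) (f false true) (f true true)
    where tf : ∀ p q r s → q ≡ p + (q - p) * + 1 + (r - p) * + 0 + (s - q - r + p) * (+ 1 * + 0)
          tf = solve-∀
  𝟙-interpolation f true  true  = tt (f false false) (f true false) (f false true) (f true true)
    where tt : ∀ p q r s → s ≡ p + (q - p) * + 1 + (r - p) * + 1 + (s - q - r + p) * (+ 1 * + 1)
          tt = solve-∀

  ∑-tabulate : ∀ {A : Set} {n} (h : Fin n → A) (f : A → ℤ) → ∑ (tabulate h) f ≡ sum (f ∘ h)
  ∑-tabulate {n = zero}  h f = refl
  ∑-tabulate {n = suc n} h f = cong (_+_ (f (h zero))) (∑-tabulate (h ∘ suc) f)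

  ∑-allFin : ∀ {n} (f : Fin n → ℤ) → ∑ (allFin n) f ≡ sum f
  ∑-allFin = ∑-tabulate (λ x → x)

  ∑-++ : ∀ {A : Set} (xs ys : List A) (f : A → ℤ) → ∑ (xs ++ ys) f ≡ ∑ xs f + ∑ ys f
  ∑-++ []       ys f = sym (ℤP.+-identityˡ _)
  ∑-++ (x ∷ xs) ys f = trans (cong (_+_ (f x)) (∑-++ xs ys f)) (sym (ℤP.+-assoc (f x) _ _))

  ∑-map : ∀ {A B : Set} (h : A → B) (xs : List A) (f : B → ℤ) → ∑ (map h xs) f ≡ ∑ xs (f ∘ h)
  ∑-map h []       f = refl
  ∑-map h (x ∷ xs) f = cong (_+_ (f (h x))) (∑-map h xs f)

  count≡∑𝟙 : ∀ {A : Set} (xs : List A) (p : A → Bool) → + count xs p ≡ ∑ xs (𝟙 ∘ p)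
  count≡∑𝟙 []       p = refl
  count≡∑𝟙 (x ∷ xs) p with p x
  ... | true  = trans (ℤP.pos-+ 1 (count xs p)) (cong (_+_ (+ 1)) (count≡∑𝟙 xs p))
  ... | false = trans (count≡∑𝟙 xs p) (sym (ℤP.+-identityˡ _))

  ∑ℕ≡∑ : ∀ {A : Set} (xs : List A) (f : A → ℕ) → + ∑ℕ xs f ≡ ∑ xs (+_ ∘ f)
  ∑ℕ≡∑ []       f = refl
  ∑ℕ≡∑ (x ∷ xs) f = trans (ℤP.pos-+ (f x) _) (cong (_+_ (+ f x)) (∑ℕ≡∑ xs f))

  count-allFin : ∀ {n} (p : Fin n → Bool) → + count (allFin n) p ≡ sum (𝟙 ∘ p)
  count-allFin {n} p = trans (count≡∑𝟙 (allFin n) p) (∑-allFin (𝟙 ∘ p))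

  ∑ℕ-allFin : ∀ {n} (f : Fin n → ℕ) → + ∑ℕ (allFin n) f ≡ sum (+_ ∘ f)
  ∑ℕ-allFin {n} f = trans (∑ℕ≡∑ (allFin n) f) (∑-allFin (+_ ∘ f))

  length≡∑1 : ∀ {A : Set} (xs : List A) → + length xs ≡ ∑ xs (λ _ → + 1)
  length≡∑1 []       = refl
  length≡∑1 (x ∷ xs) = trans (ℤP.pos-+ 1 (length xs)) (cong (_+_ (+ 1)) (length≡∑1 xs))

  ∑-filterᵇ : ∀ {A : Set} (p : A → Bool) (xs : List A) (f : A → ℤ) →
              ∑ (filterᵇ p xs) f ≡ ∑ xs (λ x → 𝟙 (p x) * f x)
  ∑-filterᵇ p []       f = refl
  ∑-filterᵇ p (x ∷ xs) f with p x
  ... | true  = cong₂ _+_ (sym (ℤP.*-identityˡ (f x))) (∑-filterᵇ p xs f)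
  ... | false = trans (∑-filterᵇ p xs f) (sym (ℤP.+-identityˡ _))

  ∑-filterᵇ-cong : ∀ {A : Set} (p : A → Bool) (xs : List A) {f g : A → ℤ} →
                   (∀ x → p x ≡ true → f x ≡ g x) → ∑ (filterᵇ p xs) f ≡ ∑ (filterᵇ p xs) g
  ∑-filterᵇ-cong p []       f≡g = refl
  ∑-filterᵇ-cong p (x ∷ xs) f≡g with p x in px
  ... | true  = cong₂ _+_ (f≡g x px) (∑-filterᵇ-cong p xs f≡g)
  ... | false = ∑-filterᵇ-cong p xs f≡g

module ListBounds where
  open import Data.Nat.Base using (_+_; _*_; _≤_; _<_; _⊔_)

  +-≡-split : ∀ {a b c d} → b ≤ a → d ≤ c → a + c ≡ b + d → a ≡ b × c ≡ d
  +-≡-split {a} {b} {c} {d} b≤a d≤c eq = a≡b , ℕP.+-cancelˡ-≡ a c d (trans eq (cong (_+ d) (sym a≡b)))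
    where a≤b : a ≤ b
          a≤b = ℕP.+-cancelʳ-≤ c a b (ℕP.≤-trans (ℕP.≤-reflexive eq) (ℕP.+-monoʳ-≤ b d≤c))
          a≡b = ℕP.≤-antisym a≤b b≤a

  ∑ℕ-lower : ∀ {A : Set} {m} (f : A → ℕ) xs → (∀ x → m ≤ f x) → m * length xs ≤ ∑ℕ xs f
  ∑ℕ-lower {m = m} f []       m≤f = ℕP.≤-reflexive (ℕP.*-zeroʳ m)
  ∑ℕ-lower {m = m} f (x ∷ xs) m≤f =
    ℕP.≤-trans (ℕP.≤-reflexive (ℕP.*-suc m (length xs))) (ℕP.+-mono-≤ (m≤f x) (∑ℕ-lower f xs m≤f))

  ∑ℕ≡*length⇔All : ∀ {A : Set} {m} (f : A → ℕ) xs → (∀ x → m ≤ f x) →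
                   ∑ℕ xs f ≡ m * length xs ⇔ All (λ x → f x ≡ m) xs
  ∑ℕ≡*length⇔All {m = m} f xs m≤f = mk⇔ (to xs) (from xs)
    where
    to : ∀ xs → ∑ℕ xs f ≡ m * length xs → All (λ x → f x ≡ m) xs
    to []       _  = []
    to (x ∷ xs) eq =
      let fx≡m , rest = +-≡-split (m≤f x) (∑ℕ-lower f xs m≤f) (trans eq (ℕP.*-suc m (length xs)))
      in fx≡m ∷ to xs rest
    from : ∀ xs → All (λ x → f x ≡ m) xs → ∑ℕ xs f ≡ m * length xs
    from []       []             = sym (ℕP.*-zeroʳ m)
    from (x ∷ xs) (fx≡m ∷ rest) = trans (cong₂ _+_ fx≡m (from xs rest)) (sym (ℕP.*-suc m (length xs)))

  maxℕ≤⇔All : ∀ {A : Set} {m} (f : A → ℕ) xs → maxℕ xs f ≤ m ⇔ All (λ x → f x ≤ m) xs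
  maxℕ≤⇔All {m = m} f xs = mk⇔ (to xs) (from xs)
    where
    to : ∀ xs → maxℕ xs f ≤ m → All (λ x → f x ≤ m) xs
    to []       _ = []
    to (x ∷ xs) ≤m = ℕP.m⊔n≤o⇒m≤o (f x) _ ≤m ∷ to xs (ℕP.m⊔n≤o⇒n≤o (f x) _ ≤m)
    from : ∀ xs → All (λ x → f x ≤ m) xs → maxℕ xs f ≤ m
    from []       []          = z≤n
    from (x ∷ xs) (fx≤m ∷ rest) = ℕP.⊔-lub fx≤m (from xs rest)

  ≤-maxℕ : ∀ {A : Set} {m} (f : A → ℕ) xs → 0 < length xs → All (λ x → m ≤ f x) xs → m ≤ maxℕ xs f
  ≤-maxℕ f (x ∷ xs) _ (m≤fx ∷ _) = ℕP.≤-trans m≤fx (ℕP.m≤m⊔n (f x) _)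

  All-filterᵇ-tabulate⇔ : ∀ {A : Set} {P : A → Set} {n} (p : A → Bool) (h : Fin n → A) →
                          All P (filterᵇ p (tabulate h)) ⇔ (∀ i → p (h i) ≡ true → P (h i))
  All-filterᵇ-tabulate⇔ {P = P} p h = mk⇔ (to h) (from h)
    where
    to : ∀ {n} (h : Fin n → _) → All P (filterᵇ p (tabulate h)) → ∀ i → p (h i) ≡ true → P (h i)
    to {suc n} h all i hi with p (h zero) in h₀ | all | i
    ... | true  | ph₀ ∷ _    | zero  = ph₀
    ... | true  | _ ∷ rest   | suc i = to (h ∘ suc) rest i hi
    ... | false | _          | zero  = contradiction (trans (sym h₀) hi) λ ()
    ... | false | rest       | suc i = to (h ∘ suc) rest i hi
    from : ∀ {n} (h : Fin n → _) → (∀ i → p (h i) ≡ true → P (h i)) → All P (filterᵇ p (tabulate h))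
    from {zero}  h ph = []
    from {suc n} h ph with p (h zero) in h₀
    ... | true  = ph zero h₀ ∷ from (h ∘ suc) (ph ∘ suc)
    ... | false = from (h ∘ suc) (ph ∘ suc)

/≡/⇔ : ∀ a b c d → (+ a ℚ./ suc c ≡ + b ℚ./ suc d) ⇔ (a ℕ.* suc d ≡ b ℕ.* suc c)
/≡/⇔ a b c d = mk⇔ (ℚP.normalize-injective-≃ a b (suc c) (suc d))
  (λ eq → ℚP.fromℚᵘ-cong {ℚᵘ.mkℚᵘ (+ a) c} {ℚᵘ.mkℚᵘ (+ b) d}
            (ℚᵘ.*≡* (trans (sym (ℤP.pos-* a (suc d))) (trans (cong +_ eq) (ℤP.pos-* b (suc c))))))

module IntegerArithmetic where
  open import Data.Integer.Base using (_+_; _*_; _-_; -_; _≤_; +≤+; ∣_∣)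
  open import Algebra.Properties.AbelianGroup ℤP.+-0-abelianGroup using (∙-cancelˡ)

  affine-injective : ∀ a c .{{_ : ℤ.NonZero c}} → Injective _≡_ _≡_ (λ u → a + c * u)
  affine-injective a c {u} {v} eq = ℤP.*-cancelˡ-≡ c u v (∙-cancelˡ a (c * u) (c * v) eq)

  +≤+⇔ : ∀ {m n} → + m ≤ + n ⇔ m ℕ.≤ n
  +≤+⇔ = mk⇔ ℤP.drop‿+≤+ +≤+

  ≤⇔0≤- : ∀ {i j} → i ≤ j ⇔ 0ℤ ≤ j - i
  ≤⇔0≤- = mk⇔ ℤP.i≤j⇒0≤j-i ℤP.0≤i-j⇒j≤i

  0≤2*⇔0≤ : ∀ i → 0ℤ ≤ + 2 * i ⇔ 0ℤ ≤ i
  0≤2*⇔0≤ i = mk⇔ (ℤP.*-cancelˡ-≤-pos 0ℤ i (+ 2)) (ℤP.*-monoˡ-≤-nonNeg (+ 2))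

  0≤w×0≤1-w⇔ : ∀ w → (0ℤ ≤ w × 0ℤ ≤ + 1 - w) ⇔ (w ≡ 0ℤ ⊎ w ≡ + 1)
  0≤w×0≤1-w⇔ w = mk⇔ (to w) from
    where
    to : ∀ w → 0ℤ ≤ w × 0ℤ ≤ + 1 - w → w ≡ 0ℤ ⊎ w ≡ + 1
    to (+ 0) _ = inj₁ refl
    to (+ 1) _ = inj₂ refl
    to (+ ℕ.suc (ℕ.suc m)) (_ , ())
    to -[1+ m ] (() , _)
    from : w ≡ 0ℤ ⊎ w ≡ + 1 → 0ℤ ≤ w × 0ℤ ≤ + 1 - w
    from (inj₁ refl) = +≤+ z≤n , +≤+ z≤n
    from (inj₂ refl) = +≤+ z≤n , +≤+ z≤n

  0≤-w⊎0≤w-1 : ∀ w → 0ℤ ≤ - w ⊎ 0ℤ ≤ w - + 1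
  0≤-w⊎0≤w-1 (+ 0)         = inj₁ (+≤+ z≤n)
  0≤-w⊎0≤w-1 (+ ℕ.suc m)   = inj₂ (+≤+ z≤n)
  0≤-w⊎0≤w-1 -[1+ m ]      = inj₁ (+≤+ z≤n)

  ≤⇔0≤ : ∀ {a m : ℕ} v → + a ≡ + m - + 2 * v → a ℕ.≤ m ⇔ 0ℤ ≤ v
  ≤⇔0≤ {a} {m} v a≡ =
    ⇔.trans (⇔.sym +≤+⇔) (⇔.trans ≤⇔0≤- (subst (λ x → 0ℤ ≤ x ⇔ 0ℤ ≤ v) (sym m-a≡2v) (0≤2*⇔0≤ v)))
    where m-a≡2v : + m - + a ≡ + 2 * v
          m-a≡2v = trans (cong (_-_ (+ m)) a≡) (lemma (+ m) v)
            where lemma : ∀ M v → M - (M - + 2 * v) ≡ + 2 * v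
                  lemma = solve-∀

  ≤-from-0≤- : ∀ {a m : ℕ} v → + a ≡ + m - + 2 * v → 0ℤ ≤ - v → m ℕ.≤ a
  ≤-from-0≤- {a} {m} v a≡ 0≤-v =
    Equivalence.to +≤+⇔ (Equivalence.from ≤⇔0≤- (subst (0ℤ ≤_) (sym a-m≡) (Equivalence.from (0≤2*⇔0≤ (- v)) 0≤-v)))
    where a-m≡ : + a - + m ≡ + 2 * - v
          a-m≡ = trans (cong (_- + m) a≡) (lemma (+ m) v)
            where lemma : ∀ M v → M - + 2 * v - M ≡ + 2 * - v
                  lemma = solve-∀

  ≤-window⇔ : ∀ {a b m : ℕ} w → + a ≡ + m - + 2 * w → + b ≡ + m - + 2 * (+ 1 - w) →
              (a ℕ.≤ m × b ℕ.≤ m) ⇔ (w ≡ 0ℤ ⊎ w ≡ + 1)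
  ≤-window⇔ w a≡ b≡ = ⇔.trans (mk⇔ (Data.Product.map (to (≤⇔0≤ w a≡)) (to (≤⇔0≤ (+ 1 - w) b≡)))
                                  (Data.Product.map (from (≤⇔0≤ w a≡)) (from (≤⇔0≤ (+ 1 - w) b≡))))
                              (0≤w×0≤1-w⇔ w)
    where open Equivalence

  ≤-window-lower : ∀ {a b m : ℕ} w → + a ≡ + m - + 2 * w → + b ≡ + m - + 2 * (+ 1 - w) →
                   m ℕ.≤ a ⊎ m ℕ.≤ b
  ≤-window-lower w a≡ b≡ =
    Sum.map (≤-from-0≤- w a≡) (≤-from-0≤- (+ 1 - w) b≡ ∘ subst (0ℤ ≤_) (lemma w)) (0≤-w⊎0≤w-1 w)
    where lemma : ∀ w → w - + 1 ≡ - (+ 1 - w)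
          lemma = solve-∀

  ∣2-4w∣-cases : ∀ w → (w ≡ 0ℤ ⊎ w ≡ + 1) ⊎ 6 ℕ.≤ ∣ + 2 - + 4 * w ∣
  ∣2-4w∣-cases (+ 0)               = inj₁ (inj₁ refl)
  ∣2-4w∣-cases (+ 1)               = inj₁ (inj₂ refl)
  ∣2-4w∣-cases (+ ℕ.suc (ℕ.suc m)) = inj₂ (ℕP.≤-trans (ℕP.m≤m+n 6 (4 ℕ.* m)) (ℕP.≤-reflexive (sym (begin
    ∣ + 2 - + 4 * (+ 2 + + m) ∣   ≡⟨ cong ∣_∣ (lemma (+ m)) ⟩
    ∣ - (+ 6 + + 4 * + m) ∣       ≡⟨ ℤP.∣-i∣≡∣i∣ (+ 6 + + 4 * + m) ⟩
    ∣ + 6 + + 4 * + m ∣           ≡⟨ cong (λ x → ∣ + 6 + x ∣) (ℤP.pos-* 4 m) ⟨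
    6 ℕ.+ 4 ℕ.* m                 ∎))))
    where lemma : ∀ x → + 2 - + 4 * (+ 2 + x) ≡ - (+ 6 + + 4 * x)
          lemma = solve-∀
  ∣2-4w∣-cases -[1+ m ]             = inj₂ (ℕP.≤-trans (ℕP.m≤m+n 6 (4 ℕ.* m)) (ℕP.≤-reflexive (sym (begin
    ∣ + 2 - + 4 * - (+ 1 + + m) ∣ ≡⟨ cong ∣_∣ (lemma (+ m)) ⟩
    ∣ + 6 + + 4 * + m ∣           ≡⟨ cong (λ x → ∣ + 6 + x ∣) (ℤP.pos-* 4 m) ⟨
    6 ℕ.+ 4 ℕ.* m                 ∎))))
    where lemma : ∀ x → + 2 - + 4 * - (+ 1 + x) ≡ + 6 + + 4 * x
          lemma = solve-∀

  2≤∣2-4w∣ : ∀ w → 2 ℕ.≤ ∣ + 2 - + 4 * w ∣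
  2≤∣2-4w∣ w with ∣2-4w∣-cases w
  ... | inj₁ (inj₁ refl) = ℕP.≤-refl
  ... | inj₁ (inj₂ refl) = ℕP.≤-refl
  ... | inj₂ 6≤          = ℕP.≤-trans (s≤s (s≤s z≤n)) 6≤

  ∣2-4w∣≡2⇔ : ∀ w → ∣ + 2 - + 4 * w ∣ ≡ 2 ⇔ (w ≡ 0ℤ ⊎ w ≡ + 1)
  ∣2-4w∣≡2⇔ w = mk⇔ to from
    where
    to : ∣ + 2 - + 4 * w ∣ ≡ 2 → w ≡ 0ℤ ⊎ w ≡ + 1
    to ≡2 with ∣2-4w∣-cases w
    ... | inj₁ w∈01 = w∈01
    ... | inj₂ 6≤   = contradiction (ℕP.≤-trans 6≤ (ℕP.≤-reflexive ≡2)) (ℕP.<⇒≱ (ℕP.m≤m+n 3 3))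
    from : w ≡ 0ℤ ⊎ w ≡ + 1 → ∣ + 2 - + 4 * w ∣ ≡ 2
    from (inj₁ refl) = refl
    from (inj₂ refl) = refl

≡⊎≡⇔≡⊎≡ : ∀ {A B C : Set} {F : A → C} {H : B → C} → Injective _≡_ _≡_ F → Injective _≡_ _≡_ H →
          ∀ {x y z u v w} → F x ≡ H u → F y ≡ H v → F z ≡ H w → (x ≡ y ⊎ x ≡ z) ⇔ (u ≡ v ⊎ u ≡ w)
≡⊎≡⇔≡⊎≡ F-inj H-inj x≅u y≅v z≅w = mk⇔
  (Sum.map (λ x≡y → H-inj (trans (sym x≅u) (trans (cong _ x≡y) y≅v)))
           (λ x≡z → H-inj (trans (sym x≅u) (trans (cong _ x≡z) z≅w))))
  (Sum.map (λ u≡v → F-inj (trans x≅u (trans (cong _ u≡v) (sym y≅v))))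
           (λ u≡w → F-inj (trans x≅u (trans (cong _ u≡w) (sym z≅w)))))

module _ {n} (G : FinAbGroup n) where
  open FinAbGroup G
  open IsAbelianGroup isAbelianGroup using (isGroup; comm)
  open Sums
  open import Data.Integer.Base using (_+_; _*_; _-_)

  toGroup : Group 0ℓ 0ℓ
  toGroup = record { isGroup = isGroup }

  open import Algebra.Properties.Group toGroup using (//-rightDividesˡ; //-rightDividesʳ)

  sum-translate : ∀ g (f : Fin n → ℤ) → sum (λ x → f (x ⊕ g)) ≡ sum f
  sum-translate g = sum-bijection (_⊕ g) (_⊖ g) (//-rightDividesˡ g) (//-rightDividesʳ g)

  x⊕g⊖g≡x : ∀ g x → x ⊕ g ⊖ g ≡ x
  x⊕g⊖g≡x = //-rightDividesʳ

  ∑-nzElems : ∀ (f : Fin n → ℤ) → ∑ nzElems f ≡ sum f - f 𝟘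
  ∑-nzElems f = begin
    ∑ nzElems f
      ≡⟨ ∑-filterᵇ nonzero elems f ⟩
    ∑ elems (λ g → 𝟙 (nonzero g) * f g)
      ≡⟨ ∑-allFin (λ g → 𝟙 (nonzero g) * f g) ⟩
    sum (λ g → 𝟙 (not (does (g Fin.≟ 𝟘))) * f g)
      ≡⟨ sum-cong-≗ (λ g → 𝟙-not (does (g Fin.≟ 𝟘)) (f g)) ⟩
    sum (λ g → f g - 𝟙 (does (g Fin.≟ 𝟘)) * f g)
      ≡⟨ sum-sub f (λ g → 𝟙 (does (g Fin.≟ 𝟘)) * f g) ⟩
    sum f - sum (λ g → 𝟙 (does (g Fin.≟ 𝟘)) * f g)
      ≡⟨ cong (_-_ (sum f)) (sum-indicator 𝟘 f) ⟩
    sum f - f 𝟘 ∎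
    where
    𝟙-not : ∀ b x → 𝟙 (not b) * x ≡ x - 𝟙 b * x
    𝟙-not false = solve-∀
    𝟙-not true  = solve-∀

  length-nzElems : + length nzElems ≡ + n - + 1
  length-nzElems = begin
    + length nzElems            ≡⟨ length≡∑1 nzElems ⟩
    ∑ nzElems (λ _ → + 1)       ≡⟨ ∑-nzElems (λ _ → + 1) ⟩
    sum {n} (λ _ → + 1) - + 1   ≡⟨ cong (_- + 1) (trans (sum-const n (+ 1)) (ℤP.*-identityʳ (+ n))) ⟩
    + n - + 1                   ∎

  quasiOrthogonal-∂⇔ : ∀ t φ → QuasiOrthogonal G t (∂ G φ) ⇔ RE G (∂ G φ) ≡ 8 ℕ.* t ℕ.+ 2
  quasiOrthogonal-∂⇔ t φ = mk⇔ (Sum.[ proj₂ , (λ (¬cob , _) → contradiction coboundary ¬cob) ])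
                                (λ RE≡ → inj₁ (coboundary , RE≡))
    where coboundary : IsCoboundary G (∂ G φ)
          coboundary = φ , λ _ _ → refl

  sum-translateˡ : ∀ x (f : Fin n → ℤ) → sum (λ g → f (x ⊕ g)) ≡ sum f
  sum-translateˡ x f = trans (sum-cong-≗ (λ g → cong f (comm x g))) (sum-translate x f)

  ⊖≡⇔≡⊕ : ∀ {x y g} → x ⊖ y ≡ g ⇔ x ≡ g ⊕ y
  ⊖≡⇔≡⊕ {x} {y} {g} = mk⇔ (λ eq → trans (sym (//-rightDividesˡ y x)) (cong (_⊕ y) eq))
                          (λ eq → trans (cong (_⊖ y) eq) (//-rightDividesʳ y g))

  ⊖≡⇔≡⊖ : ∀ {x y g} → x ⊖ y ≡ g ⇔ y ≡ x ⊖ g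
  ⊖≡⇔≡⊖ {x} {y} {g} = mk⇔
    (λ eq → sym (Equivalence.from ⊖≡⇔≡⊕ (trans (Equivalence.to ⊖≡⇔≡⊕ eq) (comm g y))))
    (λ eq → Equivalence.from ⊖≡⇔≡⊕ (trans (Equivalence.to ⊖≡⇔≡⊕ (sym eq)) (comm y g)))

module SignGraph {n} (G : FinAbGroup n) (φ : Fin n → Sign) where
  open FinAbGroup G
  open IsAbelianGroup isAbelianGroup using (comm)
  open Sums
  open import Data.Integer.Base using (_+_; _*_)

  R : E G → Bool
  R = graphSet G φ

  ∑-elemsE : ∀ (f : E G → ℤ) → ∑ (elemsE G) f ≡ sum (λ h → f (Sign.+ , h)) + sum (λ h → f (Sign.- , h))
  ∑-elemsE f = begin
    ∑ (map (Sign.+ ,_) elems ++ map (Sign.- ,_) elems ++ []) f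
      ≡⟨ ∑-++ (map (Sign.+ ,_) elems) _ f ⟩
    ∑ (map (Sign.+ ,_) elems) f + ∑ (map (Sign.- ,_) elems ++ []) f
      ≡⟨ cong (_+_ (∑ (map (Sign.+ ,_) elems) f)) (trans (∑-++ (map (Sign.- ,_) elems) [] f) (ℤP.+-identityʳ _)) ⟩
    ∑ (map (Sign.+ ,_) elems) f + ∑ (map (Sign.- ,_) elems) f
      ≡⟨ cong₂ _+_ (trans (∑-map (Sign.+ ,_) elems f) (∑-allFin (λ h → f (Sign.+ , h))))
                   (trans (∑-map (Sign.- ,_) elems f) (∑-allFin (λ h → f (Sign.- , h)))) ⟩
    sum (λ h → f (Sign.+ , h)) + sum (λ h → f (Sign.- , h)) ∎

  count-elemsE : ∀ (p : E G → Bool) → + count (elemsE G) p ≡ sum (λ h → 𝟙 (p (Sign.+ , h)) + 𝟙 (p (Sign.- , h)))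
  count-elemsE p = trans (count≡∑𝟙 (elemsE G) p)
                         (trans (∑-elemsE (𝟙 ∘ p)) (sym (∑-distrib-+ (λ h → 𝟙 (p (Sign.+ , h))) _)))

  count-elemsE-true : count (elemsE G) (λ _ → true) ≡ n ℕ.* 2
  count-elemsE-true = ℤP.+-injective (begin
    + count (elemsE G) (λ _ → true)  ≡⟨ count-elemsE (λ _ → true) ⟩
    sum {n} (λ _ → + 2)              ≡⟨ sum-const n (+ 2) ⟩
    + n * + 2                        ≡⟨ ℤP.pos-* n 2 ⟨
    + (n ℕ.* 2)                      ∎)

  count-Zfb : count (elemsE G) (Zfb G) ≡ 2
  count-Zfb = ℤP.+-injective (begin
    + count (elemsE G) (Zfb G)
      ≡⟨ count-elemsE (Zfb G) ⟩
    sum (λ h → 𝟙 (does (h Fin.≟ 𝟘)) + 𝟙 (does (h Fin.≟ 𝟘)))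
      ≡⟨ ∑-distrib-+ (λ h → 𝟙 (does (h Fin.≟ 𝟘))) _ ⟩
    sum (λ h → 𝟙 (does (h Fin.≟ 𝟘))) + sum (λ h → 𝟙 (does (h Fin.≟ 𝟘)))
      ≡⟨ cong₂ _+_ (sum-𝟙-≟ 𝟘) (sum-𝟙-≟ 𝟘) ⟩
    + 2 ∎)

  count-graphSet : count (elemsE G) R ≡ n
  count-graphSet = ℤP.+-injective (begin
    + count (elemsE G) R
      ≡⟨ count-elemsE R ⟩
    sum (λ h → 𝟙 (does (Sign.+ SignP.≟ φ h)) + 𝟙 (does (Sign.- SignP.≟ φ h)))
      ≡⟨ sum-cong-≗ (λ h → one-sign (φ h)) ⟩
    sum {n} (λ _ → + 1)
      ≡⟨ trans (sum-const n (+ 1)) (ℤP.*-identityʳ (+ n)) ⟩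
    + n ∎)
    where
    one-sign : ∀ s → 𝟙 (does (Sign.+ SignP.≟ s)) + 𝟙 (does (Sign.- SignP.≟ s)) ≡ + 1
    one-sign Sign.+ = refl
    one-sign Sign.- = refl

  graphSet-transversal : ∀ x → count (elemsE G) (λ z → Zfb G z ∧ R ((_·E_ G) x z)) ≡ 1
  graphSet-transversal (a , g) = ℤP.+-injective (begin
    + count (elemsE G) (λ z → Zfb G z ∧ R ((_·E_ G) (a , g) z))
      ≡⟨ count-elemsE _ ⟩
    sum (λ h → 𝟙 (does (h Fin.≟ 𝟘) ∧ does ((a Sign.* Sign.+) SignP.≟ φ (g ⊕ h)))
             + 𝟙 (does (h Fin.≟ 𝟘) ∧ does ((a Sign.* Sign.-) SignP.≟ φ (g ⊕ h))))
      ≡⟨ sum-cong-≗ (λ h → one-sign (does (h Fin.≟ 𝟘)) a (φ (g ⊕ h))) ⟩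
    sum (λ h → 𝟙 (does (h Fin.≟ 𝟘)))
      ≡⟨ sum-𝟙-≟ 𝟘 ⟩
    + 1 ∎)
    where
    one-sign : ∀ b a u → 𝟙 (b ∧ does ((a Sign.* Sign.+) SignP.≟ u)) + 𝟙 (b ∧ does ((a Sign.* Sign.-) SignP.≟ u))
                         ≡ 𝟙 b
    one-sign false a      u      = refl
    one-sign true  Sign.+ Sign.+ = refl
    one-sign true  Sign.+ Sign.- = refl
    one-sign true  Sign.- Sign.+ = refl
    one-sign true  Sign.- Sign.- = refl

  count-graphSet-∩-translate : ∀ a g →
    + count (elemsE G) (λ y → R y ∧ R ((_·E_ G) (invE G (a , g)) y)) ≡
    sum (λ x → 𝟙 (does ((a Sign.* φ (x ⊕ g)) SignP.≟ φ x)))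
  count-graphSet-∩-translate a g = begin
    + count (elemsE G) (λ y → R y ∧ R ((_·E_ G) (invE G (a , g)) y))
      ≡⟨ count-elemsE _ ⟩
    sum (λ h → 𝟙 (does (Sign.+ SignP.≟ φ h) ∧ does ((a Sign.* Sign.+) SignP.≟ φ (⊖ g ⊕ h)))
             + 𝟙 (does (Sign.- SignP.≟ φ h) ∧ does ((a Sign.* Sign.-) SignP.≟ φ (⊖ g ⊕ h))))
      ≡⟨ sum-cong-≗ (λ h → sign-fiber a (φ h) (φ (⊖ g ⊕ h))) ⟩
    sum (λ h → 𝟙 (does ((a Sign.* φ h) SignP.≟ φ (⊖ g ⊕ h))))
      ≡⟨ sum-translate G g (λ h → 𝟙 (does ((a Sign.* φ h) SignP.≟ φ (⊖ g ⊕ h)))) ⟨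
    sum (λ x → 𝟙 (does ((a Sign.* φ (x ⊕ g)) SignP.≟ φ (⊖ g ⊕ (x ⊕ g)))))
      ≡⟨ sum-cong-≗ (λ x → cong (λ y → 𝟙 (does ((a Sign.* φ (x ⊕ g)) SignP.≟ φ y)))
                                (trans (comm (⊖ g) (x ⊕ g)) (x⊕g⊖g≡x G g x))) ⟩
    sum (λ x → 𝟙 (does ((a Sign.* φ (x ⊕ g)) SignP.≟ φ x))) ∎
    where
    sign-fiber : ∀ a s u → 𝟙 (does (Sign.+ SignP.≟ s) ∧ does ((a Sign.* Sign.+) SignP.≟ u))
                         + 𝟙 (does (Sign.- SignP.≟ s) ∧ does ((a Sign.* Sign.-) SignP.≟ u))
                         ≡ 𝟙 (does ((a Sign.* s) SignP.≟ u))
    sign-fiber Sign.+ Sign.+ Sign.+ = refl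
    sign-fiber Sign.+ Sign.+ Sign.- = refl
    sign-fiber Sign.+ Sign.- Sign.+ = refl
    sign-fiber Sign.+ Sign.- Sign.- = refl
    sign-fiber Sign.- Sign.+ Sign.+ = refl
    sign-fiber Sign.- Sign.+ Sign.- = refl
    sign-fiber Sign.- Sign.- Sign.+ = refl
    sign-fiber Sign.- Sign.- Sign.- = refl

sign : Bool → Sign
sign b = if b then Sign.- else Sign.+

module Translates {n} (G : FinAbGroup n) (χ : Fin n → Bool) where
  open FinAbGroup G
  open IsAbelianGroup isAbelianGroup using (comm; identityʳ)
  open Sums
  open import Data.Integer.Base using (_+_; _*_; _-_; -_)

  size : ℤ
  size = sum (𝟙 ∘ χ)

  coincidences : Fin n → ℤ
  coincidences g = sum (λ x → 𝟙 (χ x) * 𝟙 (χ (x ⊕ g)))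

  -- size = |D|, coincidences g = |D ∩ (D − g)| and departures g = |D ∖ (D − g)|,
  -- where D is the support of χ.
  departures : Fin n → ℤ
  departures g = size - coincidences g

  sum-pairs : ∀ (f : Bool → Bool → ℤ) g →
              sum (λ x → f (χ x) (χ (x ⊕ g))) ≡
                f false false * (+ n - size - departures g)
                + (f true false + f false true) * departures g
                + f true true * (size - departures g)
  sum-pairs f g = begin
    sum (λ x → f (χ x) (χ (x ⊕ g)))
      ≡⟨ sum-cong-≗ (λ x → 𝟙-interpolation f (χ x) (χ (x ⊕ g))) ⟩
    sum (λ x → c₀ + c₁ * 𝟙 (χ x) + c₂ * 𝟙 (χ (x ⊕ g)) + c₃ * (𝟙 (χ x) * 𝟙 (χ (x ⊕ g))))
      ≡⟨ sum-linear c₀ c₁ c₂ c₃ (𝟙 ∘ χ) (λ x → 𝟙 (χ (x ⊕ g))) _ ⟩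
    + n * c₀ + c₁ * size + c₂ * sum (λ x → 𝟙 (χ (x ⊕ g))) + c₃ * coincidences g
      ≡⟨ cong (λ s → + n * c₀ + c₁ * size + c₂ * s + c₃ * coincidences g) (sum-translate G g (𝟙 ∘ χ)) ⟩
    + n * c₀ + c₁ * size + c₂ * size + c₃ * coincidences g
      ≡⟨ regroup (+ n) size (coincidences g) (f false false) (f true false) (f false true) (f true true) ⟩
    _ ∎
    where
    c₀ = f false false
    c₁ = f true false - f false false
    c₂ = f false true - f false false
    c₃ = f true true - f true false - f false true + f false false
    regroup : ∀ N K A p q r s →
              N * p + (q - p) * K + (r - p) * K + (s - q - r + p) * A ≡
              p * (N - K - (K - A)) + (q + r) * (K - A) + s * (K - (K - A))
    regroup = solve-∀

  autocorr≡ : ∀ g → autocorr G (signOf G χ) g ≡ + n - + 4 * departures g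
  autocorr≡ g = trans (∑-allFin (λ x → val G (sign (χ x) Sign.* sign (χ (x ⊕ g)))))
    (trans (sum-pairs (λ b c → val G (sign b Sign.* sign c)) g) (lemma (+ n) size (departures g)))
    where lemma : ∀ N K U → + 1 * (N - K - U) + (- + 1 + - + 1) * U + + 1 * (K - U) ≡ N - + 4 * U
          lemma = solve-∀

  agreements≡ : ∀ g → + count elems (λ x → does ((χ (x ⊕ g) xor χ x) Bool.≟ false)) ≡ + n - + 2 * departures g
  agreements≡ g = trans (count-allFin (λ x → does ((χ (x ⊕ g) xor χ x) Bool.≟ false)))
    (trans (sum-pairs (λ b c → 𝟙 (does ((c xor b) Bool.≟ false))) g) (lemma (+ n) size (departures g)))
    where lemma : ∀ N K U → + 1 * (N - K - U) + (+ 0 + + 0) * U + + 1 * (K - U) ≡ N - + 2 * U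
          lemma = solve-∀

  disagreements≡ : ∀ g → + count elems (λ x → does ((χ (x ⊕ g) xor χ x) Bool.≟ true)) ≡ + 2 * departures g
  disagreements≡ g = trans (count-allFin (λ x → does ((χ (x ⊕ g) xor χ x) Bool.≟ true)))
    (trans (sum-pairs (λ b c → 𝟙 (does ((c xor b) Bool.≟ true))) g) (lemma (+ n) size (departures g)))
    where lemma : ∀ N K U → + 0 * (N - K - U) + (+ 1 + + 1) * U + + 0 * (K - U) ≡ + 2 * U
          lemma = solve-∀

  diffCount≡ : ∀ g → + diffCount G χ g ≡ size - departures g
  diffCount≡ g = begin
    + diffCount G χ g
      ≡⟨ ∑ℕ-allFin (λ x → count elems (λ y → χ x ∧ χ y ∧ does ((x ⊖ y) Fin.≟ g))) ⟩
    sum (λ x → + count elems (λ y → χ x ∧ χ y ∧ does ((x ⊖ y) Fin.≟ g)))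
      ≡⟨ sum-cong-≗ inner ⟩
    sum (λ x → 𝟙 (χ x) * 𝟙 (χ (x ⊖ g)))
      ≡⟨ sum-translate G g (λ x → 𝟙 (χ x) * 𝟙 (χ (x ⊖ g))) ⟨
    sum (λ x → 𝟙 (χ (x ⊕ g)) * 𝟙 (χ (x ⊕ g ⊖ g)))
      ≡⟨ sum-cong-≗ (λ x → cong (λ y → 𝟙 (χ (x ⊕ g)) * 𝟙 (χ y)) (x⊕g⊖g≡x G g x)) ⟩
    sum (λ x → 𝟙 (χ (x ⊕ g)) * 𝟙 (χ x))
      ≡⟨ sum-pairs (λ b c → 𝟙 c * 𝟙 b) g ⟩
    + 0 * (+ n - size - departures g) + (+ 0 + + 0) * departures g + + 1 * (size - departures g)
      ≡⟨ lemma (+ n) size (departures g) ⟩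
    size - departures g ∎
    where
    inner : ∀ x → + count elems (λ y → χ x ∧ χ y ∧ does ((x ⊖ y) Fin.≟ g)) ≡ 𝟙 (χ x) * 𝟙 (χ (x ⊖ g))
    inner x = begin
      + count elems (λ y → χ x ∧ χ y ∧ does ((x ⊖ y) Fin.≟ g))
        ≡⟨ count-allFin (λ y → χ x ∧ χ y ∧ does ((x ⊖ y) Fin.≟ g)) ⟩
      sum (λ y → 𝟙 (χ x ∧ χ y ∧ does ((x ⊖ y) Fin.≟ g)))
        ≡⟨ sum-cong-≗ (λ y → trans (𝟙-∧ (χ x) _)
                                  (cong (𝟙 (χ x) *_) (trans (𝟙-∧ (χ y) _) (ℤP.*-comm (𝟙 (χ y)) _)))) ⟩
      sum (λ y → 𝟙 (χ x) * (𝟙 (does ((x ⊖ y) Fin.≟ g)) * 𝟙 (χ y)))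
        ≡⟨ *-distribˡ-sum (𝟙 (χ x)) (λ y → 𝟙 (does ((x ⊖ y) Fin.≟ g)) * 𝟙 (χ y)) ⟨
      𝟙 (χ x) * sum (λ y → 𝟙 (does ((x ⊖ y) Fin.≟ g)) * 𝟙 (χ y))
        ≡⟨ cong (𝟙 (χ x) *_) (sum-cong-≗ (λ y → cong (λ b → 𝟙 b * 𝟙 (χ y))
                                                        (does-⇔ (⊖≡⇔≡⊖ G) ((x ⊖ y) Fin.≟ g) (y Fin.≟ (x ⊖ g))))) ⟩
      𝟙 (χ x) * sum (λ y → 𝟙 (does (y Fin.≟ (x ⊖ g))) * 𝟙 (χ y))
        ≡⟨ cong (𝟙 (χ x) *_) (sum-indicator (x ⊖ g) (𝟙 ∘ χ)) ⟩
      𝟙 (χ x) * 𝟙 (χ (x ⊖ g)) ∎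
    lemma : ∀ N K U → + 0 * (N - K - U) + (+ 0 + + 0) * U + + 1 * (K - U) ≡ K - U
    lemma = solve-∀

  sum-coincidences : sum coincidences ≡ size * size
  sum-coincidences = begin
    sum (λ g → sum (λ x → 𝟙 (χ x) * 𝟙 (χ (x ⊕ g))))
      ≡⟨ ∑-comm (λ g x → 𝟙 (χ x) * 𝟙 (χ (x ⊕ g))) ⟩
    sum (λ x → sum (λ g → 𝟙 (χ x) * 𝟙 (χ (x ⊕ g))))
      ≡⟨ sum-cong-≗ (λ x → sym (*-distribˡ-sum (𝟙 (χ x)) (λ g → 𝟙 (χ (x ⊕ g))))) ⟩
    sum (λ x → 𝟙 (χ x) * sum (λ g → 𝟙 (χ (x ⊕ g))))
      ≡⟨ sum-cong-≗ (λ x → cong (𝟙 (χ x) *_) (sum-translateˡ G x (𝟙 ∘ χ))) ⟩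
    sum (λ x → 𝟙 (χ x) * size)
      ≡⟨ *-distribʳ-sum size (𝟙 ∘ χ) ⟨
    size * size ∎

  sum-departures : sum departures ≡ + n * size - size * size
  sum-departures = trans (sum-sub (λ _ → size) coincidences)
                         (cong₂ _-_ (sum-const n size) sum-coincidences)

  departures-𝟘 : departures 𝟘 ≡ 0ℤ
  departures-𝟘 = trans (cong (_-_ size) coincidences-𝟘) (ℤP.+-inverseʳ size)
    where
    𝟙-idem : ∀ b → 𝟙 b * 𝟙 b ≡ 𝟙 b
    𝟙-idem false = refl
    𝟙-idem true  = refl
    coincidences-𝟘 : coincidences 𝟘 ≡ size
    coincidences-𝟘 =
      sum-cong-≗ (λ x → trans (cong (λ y → 𝟙 (χ x) * 𝟙 (χ y)) (identityʳ x)) (𝟙-idem (χ x)))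

  ∣row-sum-∂∣≡ : ∀ g →
    ℤ.∣ ∑ elems (λ h → val G (∂ G (signOf G χ) g h)) ∣ ≡ ℤ.∣ + n - + 4 * departures g ∣
  ∣row-sum-∂∣≡ g = begin
    ℤ.∣ ∑ elems (λ h → val G (φ g Sign.* φ h Sign.* φ (g ⊕ h))) ∣
      ≡⟨ cong ℤ.∣_∣ (∑-allFin (λ h → val G (φ g Sign.* φ h Sign.* φ (g ⊕ h)))) ⟩
    ℤ.∣ sum (λ h → val G (φ g Sign.* φ h Sign.* φ (g ⊕ h))) ∣
      ≡⟨ cong ℤ.∣_∣ (sum-cong-≗ factor) ⟩
    ℤ.∣ sum (λ h → val G (φ g) * val G (φ h Sign.* φ (h ⊕ g))) ∣
      ≡⟨ cong ℤ.∣_∣ (*-distribˡ-sum (val G (φ g)) (λ h → val G (φ h Sign.* φ (h ⊕ g)))) ⟨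
    ℤ.∣ val G (φ g) * sum (λ h → val G (φ h Sign.* φ (h ⊕ g))) ∣
      ≡⟨ ∣val*∣ (φ g) _ ⟩
    ℤ.∣ sum (λ h → val G (φ h Sign.* φ (h ⊕ g))) ∣
      ≡⟨ cong ℤ.∣_∣ (trans (sym (∑-allFin (λ h → val G (φ h Sign.* φ (h ⊕ g))))) (autocorr≡ g)) ⟩
    ℤ.∣ + n - + 4 * departures g ∣ ∎
    where
    φ = signOf G χ
    val-* : ∀ s r → val G (s Sign.* r) ≡ val G s * val G r
    val-* Sign.+ Sign.+ = refl
    val-* Sign.+ Sign.- = refl
    val-* Sign.- Sign.+ = refl
    val-* Sign.- Sign.- = refl
    ∣val*∣ : ∀ s z → ℤ.∣ val G s * z ∣ ≡ ℤ.∣ z ∣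
    ∣val*∣ Sign.+ z = cong ℤ.∣_∣ (ℤP.*-identityˡ z)
    ∣val*∣ Sign.- z = trans (cong ℤ.∣_∣ (ℤP.-1*i≡-i z)) (ℤP.∣-i∣≡∣i∣ z)
    factor : ∀ h → val G (φ g Sign.* φ h Sign.* φ (g ⊕ h)) ≡ val G (φ g) * val G (φ h Sign.* φ (h ⊕ g))
    factor h = trans (cong (val G) (SignP.*-assoc (φ g) (φ h) (φ (g ⊕ h))))
                     (trans (val-* (φ g) _) (cong (λ x → val G (φ g) * val G (φ h Sign.* φ x)) (comm g h)))

  open SignGraph G (signOf G χ) using (R; count-graphSet-∩-translate)

  R∩R-translate-+≡ : ∀ g →
    + count (elemsE G) (λ y → R y ∧ R ((_·E_ G) (invE G (Sign.+ , g)) y)) ≡ + n - + 2 * departures g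
  R∩R-translate-+≡ g = trans (count-graphSet-∩-translate Sign.+ g)
    (trans (sum-pairs (λ b c → 𝟙 (does ((Sign.+ Sign.* sign c) SignP.≟ sign b))) g) (lemma (+ n) size (departures g)))
    where lemma : ∀ N K U → + 1 * (N - K - U) + (+ 0 + + 0) * U + + 1 * (K - U) ≡ N - + 2 * U
          lemma = solve-∀

  R∩R-translate--≡ : ∀ g →
    + count (elemsE G) (λ y → R y ∧ R ((_·E_ G) (invE G (Sign.- , g)) y)) ≡ + 2 * departures g
  R∩R-translate--≡ g = trans (count-graphSet-∩-translate Sign.- g)
    (trans (sum-pairs (λ b c → 𝟙 (does ((Sign.- Sign.* sign c) SignP.≟ sign b))) g) (lemma (+ n) size (departures g)))
    where lemma : ∀ N K U → + 0 * (N - K - U) + (+ 1 + + 1) * U + + 0 * (K - U) ≡ + 2 * U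
          lemma = solve-∀

module Characterisation {n} (t : ℕ) (n≡ : n ≡ 4 ℕ.* t ℕ.+ 2) (G : FinAbGroup n) (χ : Fin n → Bool) where
  open FinAbGroup G
  open Sums
  open IntegerArithmetic
  open ListBounds
  open Translates G χ
  open import Data.Integer.Base using (_+_; _*_; _-_; -_)

  offset : Fin n → ℤ
  offset g = departures g - + t

  BalancedAt : Fin n → Set
  BalancedAt g = offset g ≡ 0ℤ ⊎ offset g ≡ + 1

  Balanced : Set
  Balanced = ∀ g → nonzero g ≡ true → BalancedAt g

  +n≡4t+2 : + n ≡ + 4 * + t + + 2
  +n≡4t+2 = trans (cong +_ n≡) (trans (ℤP.pos-+ (4 ℕ.* t) 2) (cong (_+ + 2) (ℤP.pos-* 4 t)))

  ∀-nonzero-⇔ : ∀ {P : Fin n → Set} → (∀ g → P g ⇔ BalancedAt g) →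
                (∀ g → nonzero g ≡ true → P g) ⇔ Balanced
  ∀-nonzero-⇔ P⇔ = mk⇔ (λ h g nz → Equivalence.to (P⇔ g) (h g nz)) (λ h g nz → Equivalence.from (P⇔ g) (h g nz))

  balanced-at⇔ : ∀ {A : Set} {F : A → ℤ} → Injective _≡_ _≡_ F → ∀ a c .{{_ : ℤ.NonZero c}} g {x y z} →
                 F x ≡ a + c * offset g → F y ≡ a + c * 0ℤ → F z ≡ a + c * + 1 →
                 (x ≡ y ⊎ x ≡ z) ⇔ BalancedAt g
  balanced-at⇔ F-inj a c g = ≡⊎≡⇔≡⊎≡ F-inj (affine-injective a c)

  isOptimalBinaryArray⇔balanced : IsOptimalBinaryArray G (signOf G χ) ⇔ Balanced
  isOptimalBinaryArray⇔balanced = ∀-nonzero-⇔ λ g →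
    balanced-at⇔ (λ eq → eq) (+ 2) (- + 4) g
      (trans (autocorr≡ g) (trans (cong (_- + 4 * departures g) +n≡4t+2) (lemma (+ t) (departures g)))) refl refl
    where lemma : ∀ T U → + 4 * T + + 2 - + 4 * U ≡ + 2 + - + 4 * (U - T)
          lemma = solve-∀

  length-nzElems≡4t+1 : length nzElems ≡ 4 ℕ.* t ℕ.+ 1
  length-nzElems≡4t+1 = ℤP.+-injective (begin
    + length nzElems           ≡⟨ length-nzElems G ⟩
    + n - + 1                  ≡⟨ cong (_- + 1) +n≡4t+2 ⟩
    + 4 * + t + + 2 - + 1      ≡⟨ lemma (+ t) ⟩
    + 4 * + t + + 1            ≡⟨ cong (_+ + 1) (ℤP.pos-* 4 t) ⟨
    + (4 ℕ.* t ℕ.+ 1)          ∎)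
    where lemma : ∀ T → + 4 * T + + 2 - + 1 ≡ + 4 * T + + 1
          lemma = solve-∀

  rowExcess : Fin n → ℕ
  rowExcess g = ℤ.∣ ∑ elems (λ h → val G (∂ G (signOf G χ) g h)) ∣

  rowExcess≡ : ∀ g → rowExcess g ≡ ℤ.∣ + 2 - + 4 * offset g ∣
  rowExcess≡ g = trans (∣row-sum-∂∣≡ g)
    (cong ℤ.∣_∣ (trans (cong (_- + 4 * departures g) +n≡4t+2) (lemma (+ t) (departures g))))
    where lemma : ∀ T U → + 4 * T + + 2 - + 4 * U ≡ + 2 - + 4 * (U - T)
          lemma = solve-∀

  RE≡8t+2⇔All : RE G (∂ G (signOf G χ)) ≡ 8 ℕ.* t ℕ.+ 2 ⇔ All (λ g → rowExcess g ≡ 2) nzElems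
  RE≡8t+2⇔All = subst (λ m → (RE G (∂ G (signOf G χ)) ≡ m) ⇔ All (λ g → rowExcess g ≡ 2) nzElems)
                      2*length≡8t+2
                      (∑ℕ≡*length⇔All rowExcess nzElems (λ g → subst (2 ℕ.≤_) (sym (rowExcess≡ g)) (2≤∣2-4w∣ (offset g))))
    where 2*length≡8t+2 : 2 ℕ.* length nzElems ≡ 8 ℕ.* t ℕ.+ 2
          2*length≡8t+2 = trans (cong (2 ℕ.*_) length-nzElems≡4t+1) (lemma t)
            where lemma : ∀ t → 2 ℕ.* (4 ℕ.* t ℕ.+ 1) ≡ 8 ℕ.* t ℕ.+ 2
                  lemma = ℕSolver.solve-∀

  quasiOrthogonal⇔balanced : QuasiOrthogonal G t (∂ G (signOf G χ)) ⇔ Balanced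
  quasiOrthogonal⇔balanced =
    ⇔.trans (quasiOrthogonal-∂⇔ G t (signOf G χ))
    (⇔.trans RE≡8t+2⇔All
    (⇔.trans (All-filterᵇ-tabulate⇔ nonzero (λ g → g))
             (∀-nonzero-⇔ λ g → subst (λ e → (e ≡ 2) ⇔ BalancedAt g) (sym (rowExcess≡ g)) (∣2-4w∣≡2⇔ (offset g)))))

  module _ (k : ℕ) (count≡k : count elems χ ≡ k) where
    l s : ℤ
    l = + k - + (t ℕ.+ 1)
    s = + (4 ℕ.* t ℕ.+ 1) * (+ k - + t) - + k * (+ k - + 1)

    size≡k : size ≡ + k
    size≡k = trans (sym (count-allFin χ)) (cong +_ count≡k)

    diffCount≡affine : ∀ g → + diffCount G χ g ≡ (+ k - + t) + - + 1 * offset g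
    diffCount≡affine g = trans (diffCount≡ g) (trans (cong (_- departures g) size≡k) (lemma (+ k) (+ t) (departures g)))
      where lemma : ∀ K T U → K - U ≡ K - T + - + 1 * (U - T)
            lemma = solve-∀

    l+1≡ : l + + 1 ≡ (+ k - + t) + - + 1 * 0ℤ
    l+1≡ = trans (cong (λ x → + k - x + + 1) (ℤP.pos-+ t 1)) (lemma (+ k) (+ t))
      where lemma : ∀ K T → K - (T + + 1) + + 1 ≡ K - T + - + 1 * + 0
            lemma = solve-∀

    l≡ : l ≡ (+ k - + t) + - + 1 * + 1
    l≡ = trans (cong (_-_ (+ k)) (ℤP.pos-+ t 1)) (lemma (+ k) (+ t))
      where lemma : ∀ K T → K - (T + + 1) ≡ K - T + - + 1 * + 1
            lemma = solve-∀

    diffCount∈⇔balanced-at : ∀ g → (+ diffCount G χ g ≡ l ⊎ + diffCount G χ g ≡ l + + 1) ⇔ BalancedAt g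
    diffCount∈⇔balanced-at g = ⇔.trans (mk⇔ Sum.swap Sum.swap)
                                       (balanced-at⇔ (λ eq → eq) (+ k - + t) (- + 1) g (diffCount≡affine g) l+1≡ l≡)

    diffCount≡l⇔offset≡1 : ∀ g → + diffCount G χ g ≡ l ⇔ offset g ≡ + 1
    diffCount≡l⇔offset≡1 g = mk⇔
      (λ d≡l → affine-injective (+ k - + t) (- + 1) (trans (sym (diffCount≡affine g)) (trans d≡l l≡)))
      (λ w≡1 → trans (diffCount≡affine g) (trans (cong (λ w → + k - + t + - + 1 * w) w≡1) (sym l≡)))

    𝟙[diffCount≡l]≡offset : ∀ g → BalancedAt g → 𝟙 (does (+ diffCount G χ g ℤ.≟ l)) ≡ offset g
    𝟙[diffCount≡l]≡offset g w∈01 =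
      trans (cong 𝟙 (does-⇔ (diffCount≡l⇔offset≡1 g) (+ diffCount G χ g ℤ.≟ l) (offset g ℤ.≟ + 1))) (𝟙[w≡1]≡w w∈01)
      where 𝟙[w≡1]≡w : ∀ {w} → w ≡ 0ℤ ⊎ w ≡ + 1 → 𝟙 (does (w ℤ.≟ + 1)) ≡ w
            𝟙[w≡1]≡w (inj₁ refl) = refl
            𝟙[w≡1]≡w (inj₂ refl) = refl

    count-λ≡s : Balanced → + count nzElems (λ g → does (+ diffCount G χ g ℤ.≟ l)) ≡ s
    count-λ≡s balanced = begin
      + count nzElems (λ g → does (+ diffCount G χ g ℤ.≟ l))
        ≡⟨ count≡∑𝟙 nzElems _ ⟩
      ∑ nzElems (λ g → 𝟙 (does (+ diffCount G χ g ℤ.≟ l)))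
        ≡⟨ ∑-filterᵇ-cong nonzero elems (λ g nz → 𝟙[diffCount≡l]≡offset g (balanced g nz)) ⟩
      ∑ nzElems offset
        ≡⟨ ∑-nzElems G offset ⟩
      sum offset - offset 𝟘
        ≡⟨ cong₂ _-_ (sum-sub departures (λ _ → + t)) (cong (_- + t) departures-𝟘) ⟩
      sum departures - sum {n} (λ _ → + t) - (0ℤ - + t)
        ≡⟨ cong₂ (λ x y → x - y - (0ℤ - + t)) sum-departures (sum-const n (+ t)) ⟩
      + n * size - size * size - + n * + t - (0ℤ - + t)
        ≡⟨ cong₂ (λ N K → N * K - K * K - N * + t - (0ℤ - + t)) +n≡4t+2 size≡k ⟩
      (+ 4 * + t + + 2) * + k - + k * + k - (+ 4 * + t + + 2) * + t - (0ℤ - + t)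
        ≡⟨ lemma (+ t) (+ k) ⟩
      (+ 4 * + t + + 1) * (+ k - + t) - + k * (+ k - + 1)
        ≡⟨ cong (λ x → (x + + 1) * (+ k - + t) - + k * (+ k - + 1)) (ℤP.pos-* 4 t) ⟨
      s ∎
      where lemma : ∀ T K → (+ 4 * T + + 2) * K - K * K - (+ 4 * T + + 2) * T - (0ℤ - T) ≡
                            (+ 4 * T + + 1) * (K - T) - K * (K - + 1)
            lemma = solve-∀

    isAlmostDifferenceSet⇔balanced : IsAlmostDifferenceSet G (4 ℕ.* t ℕ.+ 2) k l s χ ⇔ Balanced
    isAlmostDifferenceSet⇔balanced = mk⇔
      (λ (_ , _ , _ , diffCount∈) → Equivalence.to (∀-nonzero-⇔ diffCount∈⇔balanced-at) diffCount∈)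
      (λ balanced → sym n≡ , count≡k , count-λ≡s balanced ,
                    Equivalence.from (∀-nonzero-⇔ diffCount∈⇔balanced-at) balanced)

  private
    +[2t+1∸1]≡2t : + (2 ℕ.* t ℕ.+ 1 ∸ 1) ≡ + 2 * + t
    +[2t+1∸1]≡2t = trans (cong +_ (ℕP.m+n∸n≡m (2 ℕ.* t) 1)) (ℤP.pos-* 2 t)

    +[2t+2]≡2t+2 : + (2 ℕ.* t ℕ.+ 2) ≡ + 2 * + t + + 2
    +[2t+2]≡2t+2 = trans (ℤP.pos-+ (2 ℕ.* t) 2) (cong (_+ + 2) (ℤP.pos-* 2 t))

    +suc[2t+1]≡2t+2 : + suc (2 ℕ.* t ℕ.+ 1) ≡ + 2 * + t + + 2
    +suc[2t+1]≡2t+2 = trans (cong +_ (sym (ℕP.+-suc (2 ℕ.* t) 1))) +[2t+2]≡2t+2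

  open SignGraph G (signOf G χ)

  R∩R-translate⇔balanced-at : ∀ a g →
    let c = count (elemsE G) (λ y → R y ∧ R ((_·E_ G) (invE G (a , g)) y)) in
    (c ≡ 2 ℕ.* t ℕ.+ 1 ∸ 1 ⊎ c ≡ suc (2 ℕ.* t ℕ.+ 1)) ⇔ BalancedAt g
  R∩R-translate⇔balanced-at Sign.+ g = ⇔.trans (mk⇔ Sum.swap Sum.swap)
    (balanced-at⇔ ℤP.+-injective (+ 2 * + t + + 2) (- + 2) g
      (trans (R∩R-translate-+≡ g) (trans (cong (_- + 2 * departures g) +n≡4t+2) (lemma₁ (+ t) (departures g))))
      (trans +suc[2t+1]≡2t+2 (lemma₂ (+ t)))
      (trans +[2t+1∸1]≡2t (lemma₃ (+ t))))
    where lemma₁ : ∀ T U → + 4 * T + + 2 - + 2 * U ≡ + 2 * T + + 2 + - + 2 * (U - T)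
          lemma₁ = solve-∀
          lemma₂ : ∀ T → + 2 * T + + 2 ≡ + 2 * T + + 2 + - + 2 * + 0
          lemma₂ = solve-∀
          lemma₃ : ∀ T → + 2 * T ≡ + 2 * T + + 2 + - + 2 * + 1
          lemma₃ = solve-∀
  R∩R-translate⇔balanced-at Sign.- g =
    balanced-at⇔ ℤP.+-injective (+ 2 * + t) (+ 2) g
      (trans (R∩R-translate--≡ g) (lemma₁ (+ t) (departures g)))
      (trans +[2t+1∸1]≡2t (lemma₂ (+ t)))
      (trans +suc[2t+1]≡2t+2 (lemma₃ (+ t)))
    where lemma₁ : ∀ T U → + 2 * U ≡ + 2 * T + + 2 * (U - T)
          lemma₁ = solve-∀
          lemma₂ : ∀ T → + 2 * T ≡ + 2 * T + + 2 * + 0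
          lemma₂ = solve-∀
          lemma₃ : ∀ T → + 2 * T + + 2 ≡ + 2 * T + + 2 * + 1
          lemma₃ = solve-∀

  isExtremalRQDS⇔balanced :
    IsExtremalRQDS (elemsE G) (_·E_ G) (invE G) (4 ℕ.* t ℕ.+ 2) 2 (4 ℕ.* t ℕ.+ 2) (2 ℕ.* t ℕ.+ 1) (Zfb G) R
    ⇔ Balanced
  isExtremalRQDS⇔balanced = mk⇔
    (λ (_ , _ , _ , _ , translates) g nz →
       Equivalence.to (R∩R-translate⇔balanced-at Sign.+ g) (translates (Sign.+ , g) (not-true⇒false nz)))
    (λ balanced → trans count-elemsE-true (cong (ℕ._* 2) n≡) , count-Zfb , trans count-graphSet n≡ ,
                  graphSet-transversal ,
                  λ (a , g) Zfb≡false →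
                    Equivalence.from (R∩R-translate⇔balanced-at a g) (balanced g (cong not Zfb≡false)))
    where not-true⇒false : ∀ {b} → not b ≡ true → b ≡ false
          not-true⇒false {b} nb≡true = trans (sym (BoolP.not-involutive b)) (cong not nb≡true)

  instance
    n-nonZero : NonZero n
    n-nonZero = ℕ.≢-nonZero (λ n≡0 → ℕP.m+1+n≢0 (4 ℕ.* t) (trans (sym n≡) n≡0))

  derivCount : Fin n → Bool → ℕ
  derivCount a b = count elems (λ x → does ((χ (x ⊕ a) xor χ x) Bool.≟ b))

  derivCount-false≡ : ∀ g → + derivCount g false ≡ + (2 ℕ.* t ℕ.+ 2) - + 2 * offset g
  derivCount-false≡ g = begin
    + derivCount g false             ≡⟨ agreements≡ g ⟩
    + n - + 2 * departures g         ≡⟨ cong (_- + 2 * departures g) +n≡4t+2 ⟩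
    + 4 * + t + + 2 - + 2 * departures g ≡⟨ lemma (+ t) (departures g) ⟩
    + 2 * + t + + 2 - + 2 * offset g ≡⟨ cong (_- + 2 * offset g) +[2t+2]≡2t+2 ⟨
    + (2 ℕ.* t ℕ.+ 2) - + 2 * offset g ∎
    where lemma : ∀ T U → + 4 * T + + 2 - + 2 * U ≡ + 2 * T + + 2 - + 2 * (U - T)
          lemma = solve-∀

  derivCount-true≡ : ∀ g → + derivCount g true ≡ + (2 ℕ.* t ℕ.+ 2) - + 2 * (+ 1 - offset g)
  derivCount-true≡ g = begin
    + derivCount g true              ≡⟨ disagreements≡ g ⟩
    + 2 * departures g               ≡⟨ lemma (+ t) (departures g) ⟩
    + 2 * + t + + 2 - + 2 * (+ 1 - offset g) ≡⟨ cong (_- + 2 * (+ 1 - offset g)) +[2t+2]≡2t+2 ⟨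
    + (2 ℕ.* t ℕ.+ 2) - + 2 * (+ 1 - offset g) ∎
    where lemma : ∀ T U → + 2 * U ≡ + 2 * T + + 2 - + 2 * (+ 1 - (U - T))
          lemma = solve-∀

  maxDeriv : Fin n → ℕ
  maxDeriv a = maxℕ (false ∷ true ∷ []) (derivCount a)

  maxDeriv≤⇔balanced-at : ∀ g → maxDeriv g ℕ.≤ 2 ℕ.* t ℕ.+ 2 ⇔ BalancedAt g
  maxDeriv≤⇔balanced-at g =
    ⇔.trans (maxℕ≤⇔All (derivCount g) (false ∷ true ∷ []))
    (⇔.trans (mk⇔ (λ { (≤f ∷ ≤t ∷ []) → ≤f , ≤t }) (λ (≤f , ≤t) → ≤f ∷ ≤t ∷ []))
             (≤-window⇔ (offset g) (derivCount-false≡ g) (derivCount-true≡ g)))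

  2t+2≤maxDeriv : ∀ g → 2 ℕ.* t ℕ.+ 2 ℕ.≤ maxDeriv g
  2t+2≤maxDeriv g =
    Sum.[ (λ ≤f → ℕP.≤-trans ≤f (ℕP.m≤m⊔n (derivCount g false) _)) ,
          (λ ≤t → ℕP.≤-trans ≤t (ℕP.≤-trans (ℕP.m≤m⊔n (derivCount g true) 0)
                                            (ℕP.m≤n⊔m (derivCount g false) _))) ]′
      (≤-window-lower (offset g) (derivCount-false≡ g) (derivCount-true≡ g))

  maxDerivCount≤⇔balanced : maxDerivCount G χ ℕ.≤ 2 ℕ.* t ℕ.+ 2 ⇔ Balanced
  maxDerivCount≤⇔balanced =
    ⇔.trans (maxℕ≤⇔All maxDeriv nzElems)
    (⇔.trans (All-filterᵇ-tabulate⇔ nonzero (λ g → g)) (∀-nonzero-⇔ maxDeriv≤⇔balanced-at))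

  2t+2≤maxDerivCount : 2 ℕ.* t ℕ.+ 2 ℕ.≤ maxDerivCount G χ
  2t+2≤maxDerivCount = ≤-maxℕ maxDeriv nzElems (subst (0 ℕ.<_) (sym length-nzElems≡4t+1) (ℕP.m≤n+m 1 (4 ℕ.* t)))
    (Equivalence.from (All-filterᵇ-tabulate⇔ nonzero (λ g → g)) (λ g _ → 2t+2≤maxDeriv g))

  nonlinearity≡⇔maxDerivCount≡ :
    nonlinearity G χ ≡ + (t ℕ.+ 1) ℚ./ suc (2 ℕ.* t) ⇔ maxDerivCount G χ ≡ 2 ℕ.* t ℕ.+ 2
  nonlinearity≡⇔maxDerivCount≡ =
    ⇔.trans (mk⇔ (trans (sym nonlinearity≡)) (trans nonlinearity≡))
    (⇔.trans (/≡/⇔ M (t ℕ.+ 1) (4 ℕ.* t ℕ.+ 1) (2 ℕ.* t))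
             (mk⇔ (λ eq → ℕP.*-cancelʳ-≡ M (2 ℕ.* t ℕ.+ 2) (suc (2 ℕ.* t)) (trans eq (lemma t)))
                  (λ M≡ → trans (cong (ℕ._* suc (2 ℕ.* t)) M≡) (sym (lemma t)))))
    where
    M = maxDerivCount G χ
    nonlinearity≡ : nonlinearity G χ ≡ + M ℚ./ suc (4 ℕ.* t ℕ.+ 1)
    nonlinearity≡ = ℚP./-cong {+ M} refl (trans n≡ (ℕP.+-suc (4 ℕ.* t) 1))
    lemma : ∀ t → (t ℕ.+ 1) ℕ.* suc (4 ℕ.* t ℕ.+ 1) ≡ (2 ℕ.* t ℕ.+ 2) ℕ.* suc (2 ℕ.* t)
    lemma = ℕSolver.solve-∀

  optimalNonlinearity⇔balanced : nonlinearity G χ ≡ + (t ℕ.+ 1) ℚ./ suc (2 ℕ.* t) ⇔ Balanced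
  optimalNonlinearity⇔balanced =
    ⇔.trans nonlinearity≡⇔maxDerivCount≡
    (⇔.trans (mk⇔ ℕP.≤-reflexive (λ M≤ → ℕP.≤-antisym M≤ 2t+2≤maxDerivCount)) maxDerivCount≤⇔balanced)

open import Data.Nat using (_*_; _+_)
open import Data.Product using (∃)
open import Relation.Nullary using (¬_)

theorem4 : (t n : ℕ) → 1 Data.Nat.≤ t → n ≡ 4 * t + 2 → .{{_ : NonZero n}} →
  (G : FinAbGroup n) → (χ : Fin n → Bool) → (k : ℕ) →
  count (FinAbGroup.elems G) χ ≡ k →
  let open FinAbGroup G
      φ = signOf G χ
      -- (i)
      QO = QuasiOrthogonal G t (∂ G φ)
      -- (ii)
      ADS = IsAlmostDifferenceSet G (4 * t + 2) k (+ k ℤ.- + (t + 1))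
              ((+ (4 * t + 1)) ℤ.* (+ k ℤ.- + t) ℤ.- (+ k) ℤ.* (+ k ℤ.- + 1)) χ
      -- (iii)
      RQDS = IsExtremalRQDS (elemsE G) (_·E_ G) (invE G)
               (4 * t + 2) 2 (4 * t + 2) (2 * t + 1) (Zfb G) (graphSet G φ)
      -- (iv)
      OBA = IsOptimalBinaryArray G φ
      -- (v)
      NL = nonlinearity G χ ≡ (+ (t + 1)) ℚ./ suc (2 * t)
      -- no (n, (n ± √(3n-2))/2, (n+2 ± 2√(3n-2))/4) difference set in G
      NoDS = ∀ (r k' λ' : ℕ) (ε : ℤ) → r * r ≡ 3 * n ∸ 2 → (ε ≡ + 1 ⊎ ε ≡ ℤ.- + 1) →
               (+ 2) ℤ.* (+ k') ≡ + n ℤ.+ ε ℤ.* + r →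
               (+ 4) ℤ.* (+ λ') ≡ + n ℤ.+ + 2 ℤ.+ ε ℤ.* ((+ 2) ℤ.* + r) →
               ¬ ∃ (λ D → IsDifferenceSet G n k' λ' D)
  in (QO ⇔ ADS) × (ADS ⇔ RQDS) × (RQDS ⇔ OBA) × (NoDS → (OBA ⇔ NL))
theorem4 t n _ n≡ G χ k count≡k =
  ⇔.trans quasiOrthogonal⇔balanced (⇔.sym (isAlmostDifferenceSet⇔balanced k count≡k)) ,
  ⇔.trans (isAlmostDifferenceSet⇔balanced k count≡k) (⇔.sym isExtremalRQDS⇔balanced) ,
  ⇔.trans isExtremalRQDS⇔balanced (⇔.sym isOptimalBinaryArray⇔balanced) ,
  λ _ → ⇔.trans isOptimalBinaryArray⇔balanced (⇔.sym optimalNonlinearity⇔balanced)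
  where open Characterisation t n≡ G χ
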